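{- Let $d \geq 1$, $n, n' \geq 0$ be integers and $a, a' \in k^\times$. Suppose there exists an integer $s \geq 0$ such that $n \equiv b^s n' \pmod{b^d - 1}$ and $a = \sigma^s(a')$. Then $D(d,n,a) \simeq D(d,n',a')$ in $\mathrm{Mod}^\phi_{/K}$.
   Context: Let $p$ be a prime, $k$ an algebraic closure of $\mathbb{F}_p$, $\sigma$ a field automorphism of $k$, and $b>1$ an integer. Let $K = k((u))$, equipped with the ring endomorphism $\phi\left(\sum_n a_n u^n\right) = \sum_n \sigma(a_n) u^{bn}$. The category $\mathrm{Mod}^\phi_{/K}$ has as objects finite-dimensional $K$-vector spaces $D$ together with an additive map $\phi_D : D \to D$ satisfying $\phi_D(\lambda x) = \phi(\lambda)\phi_D(x)$ for $\lambda \in K$, $x\in D$, whose image contains a $K$-basis of $D$; morphisms are $K$-linear maps commuting with the $\phi_D$'s (we write $\phi$ for $\phi_D$). For an integer $d \geq 1$, an integer $n \geq 0$ and $a \in k^\times$, $D(d,n,a)$ denotes the object $K e_0 \oplus K e_1 \oplus \cdots \oplus K e_{d-1}$ with $\phi(e_i) = e_{i+1}$ for $0 \leq i \leq d-2$ and $\phi(e_{d-1}) = a u^n e_0$ (extended $\phi$-semilinearly). -}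

module Defs where

open import Level using (Level; _⊔_)
open import Algebra.Bundles using (CommutativeRing)
open import Algebra.Morphism.Structures using (module RingMorphisms)
open import Data.Nat as ℕ using (ℕ; zero; suc)
open import Data.Nat.Divisibility as ℕD using (_∣?_)
open import Data.Nat.Primality using (Prime)
open import Data.Integer as ℤ using (ℤ; +_)
open import Data.Fin using (Fin; zero; suc; fromℕ; inject₁)
open import Data.Product using (Σ; ∃; _×_; _,_)
open import Data.List using (List; []; _∷_; _++_; [_]; length; map)
open import Data.List.Relation.Unary.Any using (Any)
open import Relation.Nullary using (¬_; yes; no)

module FieldNotions {c ℓ} (R : CommutativeRing c ℓ) where
  open CommutativeRing R

  IsField : Set (c ⊔ ℓ)
  IsField = (¬ (1# ≈ 0#)) × (∀ x → ¬ (x ≈ 0#) → ∃ λ y → x * y ≈ 1#)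

  ι : ℕ → Carrier
  ι zero = 0#
  ι (suc n) = 1# + ι n

  eval : List Carrier → Carrier → Carrier
  eval [] x = 0#
  eval (a ∷ as) x = a + x * eval as x

  -- every monic polynomial of degree ≥ 1 (coefficients cs ++ [1]) has a root
  IsAlgClosed : Set (c ⊔ ℓ)
  IsAlgClosed = ∀ (cs : List Carrier) → 1 ℕ.≤ length cs → ∃ λ x → eval (cs ++ [ 1# ]) x ≈ 0#

  IsAlgebraicOverPrimeField : Carrier → Set ℓ
  IsAlgebraicOverPrimeField x =
    ∃ λ (cs : List ℕ) → Any (λ m → ¬ (ι m ≈ 0#)) cs × eval (map ι cs) x ≈ 0#

  IsAlgClosureOfFp : ℕ → Set (c ⊔ ℓ)
  IsAlgClosureOfFp p =
    Prime p × IsField × (ι p ≈ 0#) × IsAlgClosed × (∀ x → IsAlgebraicOverPrimeField x)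

  IsFieldAut : (Carrier → Carrier) → Set (c ⊔ ℓ)
  IsFieldAut σ = RingMorphisms.IsRingIsomorphism rawRing rawRing σ

  iter : (Carrier → Carrier) → ℕ → Carrier → Carrier
  iter σ zero x = x
  iter σ (suc s) x = σ (iter σ s x)

module Laurent {c ℓ} (R : CommutativeRing c ℓ) where
  open CommutativeRing R

  -- ⟨ v , f ⟩ represents  Σ_{i ≥ 0} f(i) u^(v + i)
  record K : Set c where
    constructor ⟨_,_⟩
    field
      val   : ℤ
      coeff : ℕ → Carrier
  open K public

  coeffAt : K → ℤ → Carrier
  coeffAt x m with m ℤ.<? val x
  ... | yes _ = 0#
  ... | no  _ = coeff x ℤ.∣ m ℤ.- val x ∣

  infix 4 _≈K_
  _≈K_ : K → K → Set ℓ
  x ≈K y = ∀ m → coeffAt x m ≈ coeffAt y m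

  infixl 6 _+K_
  _+K_ : K → K → K
  x +K y = ⟨ v , (λ i → coeffAt x (v ℤ.+ + i) + coeffAt y (v ℤ.+ + i)) ⟩
    where v = val x ℤ.⊓ val y

  conv : (ℕ → Carrier) → (ℕ → Carrier) → ℕ → Carrier
  conv f g zero = f 0 * g 0
  conv f g (suc i) = f 0 * g (suc i) + conv (λ j → f (suc j)) g i

  infixl 7 _*K_
  _*K_ : K → K → K
  x *K y = ⟨ val x ℤ.+ val y , conv (coeff x) (coeff y) ⟩

  mono : Carrier → ℤ → K
  mono a n = ⟨ n , (λ { zero → a ; (suc _) → 0# }) ⟩

  -- φ(Σ a_n u^n) = Σ σ(a_n) u^(b n)
  φK : (Carrier → Carrier) → ℕ → K → K
  φK σ b x = ⟨ + b ℤ.* val x , g ⟩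
    where
    g : ℕ → Carrier
    g i with b ∣? i
    ... | yes (ℕD.divides q _) = σ (coeff x q)
    ... | no _ = 0#

  -- the φ-module D(d,n,a) = K e_0 ⊕ ... ⊕ K e_{d-1}, vectors Fin d → K

  Vect : ℕ → Set c
  Vect d = Fin d → K

  infix 4 _≈V_
  _≈V_ : ∀ {d} → Vect d → Vect d → Set ℓ
  x ≈V y = ∀ i → x i ≈K y i

  _+V_ : ∀ {d} → Vect d → Vect d → Vect d
  (x +V y) i = x i +K y i

  _·V_ : ∀ {d} → K → Vect d → Vect d
  (λ' ·V x) i = λ' *K x i

  -- φ on D(d,n,a):  φ(Σ x_i e_i) = Σ_{i<d-1} φ(x_i) e_{i+1} + φ(x_{d-1}) a u^n e_0
  φD : (σ : Carrier → Carrier) (b : ℕ) (d n : ℕ) (a : Carrier) → Vect d → Vect d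
  φD σ b zero n a x ()
  φD σ b (suc d') n a x zero = mono a (+ n) *K φK σ b (x (fromℕ d'))
  φD σ b (suc d') n a x (suc i) = φK σ b (x (inject₁ i))

  record IsMorphism (σ : Carrier → Carrier) (b d n : ℕ) (a : Carrier) (n' : ℕ) (a' : Carrier)
                    (F : Vect d → Vect d) : Set (c ⊔ ℓ) where
    field
      cong-F : ∀ {x y} → x ≈V y → F x ≈V F y
      additive : ∀ x y → F (x +V y) ≈V F x +V F y
      homogeneous : ∀ (λ' : K) x → F (λ' ·V x) ≈V λ' ·V F x
      commutes : ∀ x → F (φD σ b d n a x) ≈V φD σ b d n' a' (F x)

  record DIso (σ : Carrier → Carrier) (b d n : ℕ) (a : Carrier) (n' : ℕ) (a' : Carrier)
         : Set (c ⊔ ℓ) where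
    field
      to : Vect d → Vect d
      from : Vect d → Vect d
      to-mor : IsMorphism σ b d n a n' a' to
      from-mor : IsMorphism σ b d n' a' n a from
      from∘to : ∀ x → from (to x) ≈V x
      to∘from : ∀ y → to (from y) ≈V y

module Submission where

-- The isomorphism D(d,n,a) ≃ D(d,n',a') is built from two explicit families of
-- isomorphisms, both of the form  x ↦ (f_i (x_{π i}))_i  ("weighted
-- permutations": a permutation π of the coordinates followed by multiplication
-- of each coordinate by a monomial α u^m ∈ K):
--
-- * twisting: if n - n'' = c (b^d - 1) with c ∈ ℤ, then e_i ↦ u^{b^i c} e_i
--   gives D(d,n,a) ≃ D(d,n'',a);
-- * shifting: if a is a unit, rotating the coordinates and multiplying the
--   wrapped-around one by a u^n gives D(d,bn,σ(a)) ≃ D(d,n,a); iterating it,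
--   D(d,b^s n',σ^s(a')) ≃ D(d,n',a').
--
-- The theorem composes the
-- twist absorbing n ≡ b^s n' (mod b^d - 1) with the s-fold shift.

open import Defs
open import Level using (Level)
open import Level using (_⊔_)
open import Algebra.Bundles using (CommutativeRing)
open import Data.Nat using (ℕ; _≤_; _<_; _^_; _*_; _∸_)
open import Data.Integer using (+_; _-_)
open import Data.Integer.Divisibility using (_∣_)
open import Relation.Nullary using (¬_)

open import Data.Nat using (zero; suc; >-nonZero)
import Data.Nat.Properties as ℕP
import Data.Nat.Divisibility as ℕD
open import Data.Integer as ℤ using (ℤ)
import Data.Integer.Properties as ℤP
import Data.Integer.Divisibility.Signed as ℤDS
open import Data.Integer.Tactic.RingSolver using (solve-∀)
open import Data.Fin using (Fin; zero; suc; fromℕ; inject₁; toℕ)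
open import Data.Fin.Properties using (toℕ-fromℕ; toℕ-inject₁)
open import Data.Fin.Relation.Unary.Top
  using (View; ‵fromℕ; ‵inject₁; view; view-fromℕ; view-inject₁)
open import Data.Product using (proj₁; proj₂; ∃)
open import Relation.Nullary using (yes; no)
open import Relation.Nullary.Negation using (contradiction)
open import Relation.Binary.PropositionalEquality as P using (_≡_)
open import Relation.Binary.Bundles using (Setoid)
open import Algebra.Morphism.Structures using (module RingMorphisms)
import Algebra.Properties.CommutativeSemigroup as CommSemigroupProperties
import Relation.Binary.Reasoning.Setoid as SetoidReasoning

<+⇒-< : ∀ j m v → j ℤ.< m ℤ.+ v → j ℤ.- m ℤ.< v
<+⇒-< j m v j<m+v = P.subst (j ℤ.- m ℤ.<_) (cancel m v) (ℤP.+-monoˡ-< (ℤ.- m) j<m+v)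
  where cancel : ∀ m v → m ℤ.+ v ℤ.- m ≡ v
        cancel = solve-∀

-<⇒<+ : ∀ j m v → j ℤ.- m ℤ.< v → j ℤ.< m ℤ.+ v
-<⇒<+ j m v j-m<v = P.subst₂ ℤ._<_ (cancel j m) (ℤP.+-comm v m) (ℤP.+-monoˡ-< m j-m<v)
  where cancel : ∀ j m → j ℤ.- m ℤ.+ m ≡ j
        cancel = solve-∀

minus-sum : ∀ j m v → j ℤ.- (m ℤ.+ v) ≡ j ℤ.- m ℤ.- v
minus-sum = solve-∀

≮⇒+∣-∣ : ∀ j v → ¬ (j ℤ.< v) → v ℤ.+ + ℤ.∣ j ℤ.- v ∣ ≡ j
≮⇒+∣-∣ j v j≮v =
  P.trans (P.cong (λ t → v ℤ.+ t) (ℤP.0≤i⇒+∣i∣≡i (ℤP.i≤j⇒0≤j-i (ℤP.≮⇒≥ j≮v)))) (cancel j v)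
  where cancel : ∀ j v → v ℤ.+ (j ℤ.- v) ≡ j
        cancel = solve-∀

lastOrInject : ∀ {p m} {P : Fin (suc m) → Set p} → P (fromℕ m) → (∀ j → P (inject₁ j)) → ∀ i → P i
lastOrInject {P = P} last inject i = byView (view i)
  where byView : ∀ {i} → View i → P i
        byView ‵fromℕ = last
        byView (‵inject₁ j) = inject j

module MonomialCalculus {c ℓ} (R : CommutativeRing c ℓ) where
  open CommutativeRing R hiding (zero; _-_) renaming (_*_ to _⋆_)
  open Laurent R

  K-setoid : Setoid c ℓ
  K-setoid = record
    { Carrier = K ; _≈_ = _≈K_
    ; isEquivalence = record
      { refl = λ m → refl ; sym = λ e m → sym (e m) ; trans = λ e e' m → trans (e m) (e' m) } }

  module ≈K = Setoid K-setoid

  ⟨⟩-cong : ∀ {v w f g} → v ≡ w → (∀ i → f i ≈ g i) → ⟨ v , f ⟩ ≈K ⟨ w , g ⟩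
  ⟨⟩-cong {v} P.refl f≈g m with m ℤ.<? v
  ... | yes _ = refl
  ... | no _ = f≈g _

  conv-zeroˡ : ∀ g i → conv (λ _ → 0#) g i ≈ 0#
  conv-zeroˡ g zero = zeroˡ _
  conv-zeroˡ g (suc i) = trans (+-cong (zeroˡ _) (conv-zeroˡ g i)) (+-identityˡ _)

  conv-mono : ∀ α m g i → conv (coeff (mono α m)) g i ≈ α ⋆ g i
  conv-mono α m g zero = refl
  conv-mono α m g (suc i) = trans (+-cong refl (conv-zeroˡ g i)) (+-identityʳ _)

  conv-congʳ : ∀ f {g g'} → (∀ i → g i ≈ g' i) → ∀ i → conv f g i ≈ conv f g' i
  conv-congʳ f g≈g' zero = *-cong refl (g≈g' 0)
  conv-congʳ f g≈g' (suc i) =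
    +-cong (*-cong refl (g≈g' (suc i))) (conv-congʳ (λ j → f (suc j)) g≈g' i)

  conv-scaleʳ : ∀ f g α i → conv f (λ j → α ⋆ g j) i ≈ α ⋆ conv f g i
  conv-scaleʳ f g α zero = x∙yz≈y∙xz _ _ _
    where open CommSemigroupProperties *-commutativeSemigroup
  conv-scaleʳ f g α (suc i) =
    trans (+-cong (x∙yz≈y∙xz _ _ _) (conv-scaleʳ (λ j → f (suc j)) g α i)) (sym (distribˡ _ _ _))
    where open CommSemigroupProperties *-commutativeSemigroup

  coeff-mono* : ∀ α m x j → coeffAt (mono α m *K x) j ≈ α ⋆ coeffAt x (j ℤ.- m)
  coeff-mono* α m ⟨ v , f ⟩ j with j ℤ.<? m ℤ.+ v | j ℤ.- m ℤ.<? v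
  ... | yes _ | yes _ = sym (zeroʳ _)
  ... | yes j<m+v | no j-m≮v = contradiction (<+⇒-< j m v j<m+v) j-m≮v
  ... | no j≮m+v | yes j-m<v = contradiction (-<⇒<+ j m v j-m<v) j≮m+v
  ... | no _ | no _ =
    trans (conv-mono α m f _) (*-cong refl (reflexive (P.cong (λ t → f ℤ.∣ t ∣) (minus-sum j m v))))

  coeff-+K : ∀ x y j → coeffAt (x +K y) j ≈ coeffAt x j + coeffAt y j
  coeff-+K ⟨ v , f ⟩ ⟨ w , g ⟩ j with j ℤ.<? v ℤ.⊓ w
  ... | yes j<v⊓w = below
    where
    below : 0# ≈ coeffAt ⟨ v , f ⟩ j + coeffAt ⟨ w , g ⟩ j
    below with j ℤ.<? v | j ℤ.<? w
    ... | yes _ | yes _ = sym (+-identityˡ _)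
    ... | no j≮v | _ = contradiction (ℤP.<-≤-trans j<v⊓w (ℤP.i⊓j≤i v w)) j≮v
    ... | yes _ | no j≮w = contradiction (ℤP.<-≤-trans j<v⊓w (ℤP.i⊓j≤j v w)) j≮w
  ... | no j≮v⊓w =
    reflexive (P.cong (λ t → coeffAt ⟨ v , f ⟩ t + coeffAt ⟨ w , g ⟩ t) (≮⇒+∣-∣ j (v ℤ.⊓ w) j≮v⊓w))

  record IsLinear (F : K → K) : Set (c ⊔ ℓ) where
    field
      cong        : ∀ {x y} → x ≈K y → F x ≈K F y
      additive    : ∀ x y → F (x +K y) ≈K F x +K F y
      homogeneous : ∀ l x → F (l *K x) ≈K l *K F x

  id-linear : IsLinear (λ x → x)
  id-linear = record { cong = λ e → e ; additive = λ _ _ → ≈K.refl ; homogeneous = λ _ _ → ≈K.refl }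

  mono*-linear : ∀ α m → IsLinear (mono α m *K_)
  mono*-linear α m = record { cong = cong ; additive = additive ; homogeneous = homogeneous }
    where
    open SetoidReasoning setoid
    cong : ∀ {x y} → x ≈K y → mono α m *K x ≈K mono α m *K y
    cong {x} {y} x≈y j = begin
      coeffAt (mono α m *K x) j   ≈⟨ coeff-mono* α m x j ⟩
      α ⋆ coeffAt x (j ℤ.- m)     ≈⟨ *-cong refl (x≈y (j ℤ.- m)) ⟩
      α ⋆ coeffAt y (j ℤ.- m)     ≈⟨ coeff-mono* α m y j ⟨
      coeffAt (mono α m *K y) j   ∎
    additive : ∀ x y → mono α m *K (x +K y) ≈K mono α m *K x +K mono α m *K y
    additive x y j = begin
      coeffAt (mono α m *K (x +K y)) j                      ≈⟨ coeff-mono* α m (x +K y) j ⟩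
      α ⋆ coeffAt (x +K y) (j ℤ.- m)                        ≈⟨ *-cong refl (coeff-+K x y (j ℤ.- m)) ⟩
      α ⋆ (coeffAt x (j ℤ.- m) + coeffAt y (j ℤ.- m))       ≈⟨ distribˡ _ _ _ ⟩
      α ⋆ coeffAt x (j ℤ.- m) + α ⋆ coeffAt y (j ℤ.- m)     ≈⟨ +-cong (coeff-mono* α m x j) (coeff-mono* α m y j) ⟨
      coeffAt (mono α m *K x) j + coeffAt (mono α m *K y) j ≈⟨ coeff-+K (mono α m *K x) (mono α m *K y) j ⟨
      coeffAt (mono α m *K x +K mono α m *K y) j            ∎
    homogeneous : ∀ l y → mono α m *K (l *K y) ≈K l *K (mono α m *K y)
    homogeneous ⟨ vl , fl ⟩ ⟨ vy , fy ⟩ = ⟨⟩-cong (shuffle m vl vy) λ i → begin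
      conv (coeff (mono α m)) (conv fl fy) i ≈⟨ conv-mono α m _ i ⟩
      α ⋆ conv fl fy i                       ≈⟨ conv-scaleʳ fl fy α i ⟨
      conv fl (λ j → α ⋆ fy j) i             ≈⟨ conv-congʳ fl (λ j → conv-mono α m fy j) i ⟨
      conv fl (conv (coeff (mono α m)) fy) i ∎
      where shuffle : ∀ m vl vy → m ℤ.+ (vl ℤ.+ vy) ≡ vl ℤ.+ (m ℤ.+ vy)
            shuffle = solve-∀

  mono*-mono* : ∀ α β m m' z → mono α m *K (mono β m' *K z) ≈K mono (α ⋆ β) (m ℤ.+ m') *K z
  mono*-mono* α β m m' z j = begin
    coeffAt (mono α m *K (mono β m' *K z)) j ≈⟨ coeff-mono* α m _ j ⟩
    α ⋆ coeffAt (mono β m' *K z) (j ℤ.- m)   ≈⟨ *-cong refl (coeff-mono* β m' z (j ℤ.- m)) ⟩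
    α ⋆ (β ⋆ coeffAt z (j ℤ.- m ℤ.- m'))     ≈⟨ *-assoc _ _ _ ⟨
    (α ⋆ β) ⋆ coeffAt z (j ℤ.- m ℤ.- m')     ≈⟨ *-cong refl (reflexive (P.cong (coeffAt z) (minus-sum j m m'))) ⟨
    (α ⋆ β) ⋆ coeffAt z (j ℤ.- (m ℤ.+ m'))   ≈⟨ coeff-mono* (α ⋆ β) (m ℤ.+ m') z j ⟨
    coeffAt (mono (α ⋆ β) (m ℤ.+ m') *K z) j ∎
    where open SetoidReasoning setoid

  mono*-congˡ : ∀ {α α' m m'} z → α ≈ α' → m ≡ m' → mono α m *K z ≈K mono α' m' *K z
  mono*-congˡ {α} {α'} {m} z α≈α' P.refl j =
    trans (coeff-mono* α m z j) (trans (*-cong α≈α' refl) (sym (coeff-mono* α' m z j)))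

  mono*-identity : ∀ z → mono 1# (+ 0) *K z ≈K z
  mono*-identity z j =
    trans (coeff-mono* 1# (+ 0) z j) (trans (*-identityˡ _) (reflexive (P.cong (coeffAt z) (ℤP.+-identityʳ j))))

  mono*-cancel : ∀ {α β} m m' z → α ⋆ β ≈ 1# → m ℤ.+ m' ≡ + 0 → mono α m *K (mono β m' *K z) ≈K z
  mono*-cancel {α} {β} m m' z αβ≈1 m+m'≡0 =
    ≈K.trans (mono*-mono* α β m m' z) (≈K.trans (mono*-congˡ z αβ≈1 m+m'≡0) (mono*-identity z))

module Isomorphisms {c ℓ} (R : CommutativeRing c ℓ)
  (σ : CommutativeRing.Carrier R → CommutativeRing.Carrier R)
  (σ-hom : RingMorphisms.IsRingHomomorphism (CommutativeRing.rawRing R) (CommutativeRing.rawRing R) σ)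
  (b : ℕ) where
  open CommutativeRing R hiding (zero; _-_) renaming (_*_ to _⋆_)
  open RingMorphisms.IsRingHomomorphism σ-hom using (⟦⟧-cong; *-homo; 1#-homo)
  open Laurent R
  open MonomialCalculus R
  open FieldNotions R using (iter)

  φK-mono* : ∀ α m y → φK σ b (mono α m *K y) ≈K mono (σ α) (+ b ℤ.* m) *K φK σ b y
  φK-mono* α m ⟨ v , f ⟩ =
    ⟨⟩-cong (ℤP.*-distribˡ-+ (+ b) m v) λ i → trans (coeffs i) (sym (conv-mono (σ α) (+ b ℤ.* m) _ i))
    where
    coeffs : ∀ i → coeff (φK σ b (mono α m *K ⟨ v , f ⟩)) i ≈ σ α ⋆ coeff (φK σ b ⟨ v , f ⟩) i
    coeffs i with b ℕD.∣? i
    ... | yes (ℕD.divides q _) = trans (⟦⟧-cong (conv-mono α m f q)) (*-homo α (f q))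
    ... | no _ = sym (zeroʳ _)

  φK-mono*ℕ : ∀ α n y → φK σ b (mono α (+ n) *K y) ≈K mono (σ α) (+ (b * n)) *K φK σ b y
  φK-mono*ℕ α n y = ≈K.trans (φK-mono* α (+ n) y) (mono*-congˡ _ refl (P.sym (ℤP.pos-* b n)))

  identityIso : ∀ {d n a} → DIso σ b d n a n a
  identityIso = record
    { to = λ x → x ; from = λ x → x ; to-mor = id-mor ; from-mor = id-mor
    ; from∘to = λ _ _ → ≈K.refl ; to∘from = λ _ _ → ≈K.refl }
    where
    id-mor : ∀ {d n a} → IsMorphism σ b d n a n a (λ x → x)
    id-mor = record
      { cong-F = λ e → e ; additive = λ _ _ _ → ≈K.refl
      ; homogeneous = λ _ _ _ → ≈K.refl ; commutes = λ _ _ → ≈K.refl }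

  ∘-isMorphism : ∀ {d n a n' a' n'' a''} {F G} →
    IsMorphism σ b d n a n' a' F → IsMorphism σ b d n' a' n'' a'' G →
    IsMorphism σ b d n a n'' a'' (λ x → G (F x))
  ∘-isMorphism F-mor G-mor = record
    { cong-F = λ e → G.cong-F (F.cong-F e)
    ; additive = λ x y i → ≈K.trans (G.cong-F (F.additive x y) i) (G.additive _ _ i)
    ; homogeneous = λ l x i → ≈K.trans (G.cong-F (F.homogeneous l x) i) (G.homogeneous l _ i)
    ; commutes = λ x i → ≈K.trans (G.cong-F (F.commutes x) i) (G.commutes _ i) }
    where module F = IsMorphism F-mor
          module G = IsMorphism G-mor

  isoTrans : ∀ {d n a n' a' n'' a''} →
    DIso σ b d n a n' a' → DIso σ b d n' a' n'' a'' → DIso σ b d n a n'' a''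
  isoTrans I J = record
    { to = λ x → J.to (I.to x) ; from = λ y → I.from (J.from y)
    ; to-mor = ∘-isMorphism I.to-mor J.to-mor ; from-mor = ∘-isMorphism J.from-mor I.from-mor
    ; from∘to = λ x i → ≈K.trans (IsMorphism.cong-F I.from-mor (J.from∘to _) i) (I.from∘to x i)
    ; to∘from = λ y i → ≈K.trans (IsMorphism.cong-F J.to-mor (I.to∘from _) i) (J.to∘from y i) }
    where module I = DIso I
          module J = DIso J

  weightedPerm : ∀ {d} → (Fin d → Fin d) → (Fin d → K → K) → Vect d → Vect d
  weightedPerm π f x i = f i (x (π i))

  weightedPerm-isMorphism : ∀ {d n a n' a'} π f → (∀ i → IsLinear (f i)) →
    (∀ x → weightedPerm π f (φD σ b d n a x) ≈V φD σ b d n' a' (weightedPerm π f x)) →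
    IsMorphism σ b d n a n' a' (weightedPerm π f)
  weightedPerm-isMorphism π f f-linear commutes = record
    { cong-F = λ e i → IsLinear.cong (f-linear i) (e (π i))
    ; additive = λ x y i → IsLinear.additive (f-linear i) (x (π i)) (y (π i))
    ; homogeneous = λ l x i → IsLinear.homogeneous (f-linear i) l (x (π i))
    ; commutes = commutes }

  module Twist (d' : ℕ) where
    twistExp : ℤ → Fin (suc d') → ℤ
    twistExp c i = + (b ^ toℕ i) ℤ.* c

    twist : ℤ → Vect (suc d') → Vect (suc d')
    twist c = weightedPerm (λ i → i) (λ i → mono 1# (twistExp c i) *K_)

    -- φ multiplies exponents by b, matching the twist on the next coordinate …
    twistExp-suc : ∀ c i → twistExp c (suc i) ≡ + b ℤ.* twistExp c (inject₁ i)
    twistExp-suc c i = begin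
      + (b * b ^ toℕ i) ℤ.* c                ≡⟨ P.cong (ℤ._* c) (ℤP.pos-* b (b ^ toℕ i)) ⟩
      + b ℤ.* + (b ^ toℕ i) ℤ.* c            ≡⟨ ℤP.*-assoc (+ b) (+ (b ^ toℕ i)) c ⟩
      + b ℤ.* (+ (b ^ toℕ i) ℤ.* c)          ≡⟨ P.cong (λ k → + b ℤ.* (+ (b ^ k) ℤ.* c)) (toℕ-inject₁ i) ⟨
      + b ℤ.* twistExp c (inject₁ i)         ∎
      where open P.≡-Reasoning

    -- … and, on wrapping around from e_{d-1} to e_0, the defect b^d c - c is
    -- exactly the change n - n'' of exponent.
    twistExp-wrap : ∀ {n n''} c → + n ℤ.- + n'' ≡ c ℤ.* (+ (b ^ suc d') ℤ.- + 1) →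
      twistExp c zero ℤ.+ + n ≡ + n'' ℤ.+ + b ℤ.* twistExp c (fromℕ d')
    twistExp-wrap {n} {n''} c n-n'' = begin
      + 1 ℤ.* c ℤ.+ + n                                ≡⟨ regroup (+ n) (+ n'') c ⟩
      (+ n ℤ.- + n'') ℤ.+ + n'' ℤ.+ c                  ≡⟨ P.cong (λ t → t ℤ.+ + n'' ℤ.+ c) n-n'' ⟩
      c ℤ.* (+ (b ^ suc d') ℤ.- + 1) ℤ.+ + n'' ℤ.+ c   ≡⟨ P.cong (λ t → c ℤ.* (t ℤ.- + 1) ℤ.+ + n'' ℤ.+ c) (ℤP.pos-* b (b ^ d')) ⟩
      c ℤ.* (+ b ℤ.* B ℤ.- + 1) ℤ.+ + n'' ℤ.+ c        ≡⟨ expand c (+ n'') (+ b) B ⟩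
      + n'' ℤ.+ + b ℤ.* (B ℤ.* c)                      ≡⟨ P.cong (λ k → + n'' ℤ.+ + b ℤ.* (+ (b ^ k) ℤ.* c)) (toℕ-fromℕ d') ⟨
      + n'' ℤ.+ + b ℤ.* twistExp c (fromℕ d')          ∎
      where
      open P.≡-Reasoning
      B = + (b ^ d')
      regroup : ∀ n n'' c → + 1 ℤ.* c ℤ.+ n ≡ (n ℤ.- n'') ℤ.+ n'' ℤ.+ c
      regroup = solve-∀
      expand : ∀ c n'' b B → c ℤ.* (b ℤ.* B ℤ.- + 1) ℤ.+ n'' ℤ.+ c ≡ n'' ℤ.+ b ℤ.* (B ℤ.* c)
      expand = solve-∀

    -- Only coordinate 0 needs the hypothesis on n - n''.
    twist-isMorphism : ∀ {n n'' a a₂} c → a ≈ a₂ → + n ℤ.- + n'' ≡ c ℤ.* (+ (b ^ suc d') ℤ.- + 1) →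
      IsMorphism σ b (suc d') n a n'' a₂ (twist c)
    twist-isMorphism {n} {n''} {a} {a₂} c a≈a₂ n-n'' =
      weightedPerm-isMorphism _ _ (λ i → mono*-linear 1# (twistExp c i)) commutes
      where
      open SetoidReasoning K-setoid
      ε = twistExp c
      a≈a₂σ1 : 1# ⋆ a ≈ a₂ ⋆ σ 1#
      a≈a₂σ1 = trans (*-identityˡ a) (trans a≈a₂ (trans (sym (*-identityʳ a₂)) (*-cong refl (sym 1#-homo))))
      commutes : ∀ x → twist c (φD σ b (suc d') n a x) ≈V φD σ b (suc d') n'' a₂ (twist c x)
      commutes x zero = begin
        mono 1# (ε zero) *K (mono a (+ n) *K Φ)                    ≈⟨ mono*-mono* 1# a (ε zero) (+ n) Φ ⟩
        mono (1# ⋆ a) (ε zero ℤ.+ + n) *K Φ                        ≈⟨ mono*-congˡ Φ a≈a₂σ1 (twistExp-wrap c n-n'') ⟩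
        mono (a₂ ⋆ σ 1#) (+ n'' ℤ.+ + b ℤ.* ε (fromℕ d')) *K Φ    ≈⟨ mono*-mono* a₂ (σ 1#) (+ n'') (+ b ℤ.* ε (fromℕ d')) Φ ⟨
        mono a₂ (+ n'') *K (mono (σ 1#) (+ b ℤ.* ε (fromℕ d')) *K Φ)
          ≈⟨ IsLinear.cong (mono*-linear a₂ (+ n'')) (φK-mono* 1# (ε (fromℕ d')) (x (fromℕ d'))) ⟨
        mono a₂ (+ n'') *K φK σ b (mono 1# (ε (fromℕ d')) *K x (fromℕ d')) ∎
        where Φ = φK σ b (x (fromℕ d'))
      commutes x (suc i) = begin
        mono 1# (ε (suc i)) *K φK σ b (x (inject₁ i))                  ≈⟨ mono*-congˡ _ (sym 1#-homo) (twistExp-suc c i) ⟩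
        mono (σ 1#) (+ b ℤ.* ε (inject₁ i)) *K φK σ b (x (inject₁ i))  ≈⟨ φK-mono* 1# (ε (inject₁ i)) (x (inject₁ i)) ⟨
        φK σ b (mono 1# (ε (inject₁ i)) *K x (inject₁ i))              ∎

    twistIso : ∀ {n n'' a a₂} c → a ≈ a₂ → + n ℤ.- + n'' ≡ c ℤ.* (+ (b ^ suc d') ℤ.- + 1) →
      DIso σ b (suc d') n a n'' a₂
    twistIso {n} {n''} c a≈a₂ n-n'' = record
      { to = twist c ; from = twist (ℤ.- c)
      ; to-mor = twist-isMorphism c a≈a₂ n-n''
      ; from-mor = twist-isMorphism (ℤ.- c) (sym a≈a₂) n''-n
      ; from∘to = λ x i → mono*-cancel (twistExp (ℤ.- c) i) (twistExp c i) (x i) (*-identityˡ 1#)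
                   (cancel-neg (+ (b ^ toℕ i)) c)
      ; to∘from = λ x i → mono*-cancel (twistExp c i) (twistExp (ℤ.- c) i) (x i) (*-identityˡ 1#)
                   (cancel-pos (+ (b ^ toℕ i)) c) }
      where
      n''-n : + n'' ℤ.- + n ≡ ℤ.- c ℤ.* (+ (b ^ suc d') ℤ.- + 1)
      n''-n = begin
        + n'' ℤ.- + n                              ≡⟨ swap (+ n) (+ n'') ⟩
        ℤ.- (+ n ℤ.- + n'')                        ≡⟨ P.cong ℤ.-_ n-n'' ⟩
        ℤ.- (c ℤ.* (+ (b ^ suc d') ℤ.- + 1))       ≡⟨ ℤP.neg-distribˡ-* c _ ⟩
        ℤ.- c ℤ.* (+ (b ^ suc d') ℤ.- + 1)         ∎
        where open P.≡-Reasoning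
              swap : ∀ n n'' → n'' ℤ.- n ≡ ℤ.- (n ℤ.- n'')
              swap = solve-∀
      cancel-neg : ∀ B c → B ℤ.* ℤ.- c ℤ.+ B ℤ.* c ≡ + 0
      cancel-neg = solve-∀
      cancel-pos : ∀ B c → B ℤ.* c ℤ.+ B ℤ.* ℤ.- c ≡ + 0
      cancel-pos = solve-∀

  module Shift {n : ℕ} {a a⁻¹ : Carrier} (a⋆a⁻¹≈1 : a ⋆ a⁻¹ ≈ 1#) where
    weight unweight : K → K
    weight z = mono a (+ n) *K z
    unweight z = mono a⁻¹ (ℤ.- (+ n)) *K z

    unweight∘weight : ∀ z → unweight (weight z) ≈K z
    unweight∘weight z = mono*-cancel (ℤ.- (+ n)) (+ n) z (trans (*-comm a⁻¹ a) a⋆a⁻¹≈1) (ℤP.+-inverseˡ (+ n))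

    weight∘unweight : ∀ z → weight (unweight z) ≈K z
    weight∘unweight z = mono*-cancel (+ n) (ℤ.- (+ n)) z a⋆a⁻¹≈1 (ℤP.+-inverseʳ (+ n))

    -- φ turns the weight a u^n into σ(a) u^{bn}, which still cancels unweight.
    σweight∘φ∘unweight : ∀ z → mono (σ a) (+ (b * n)) *K φK σ b (unweight z) ≈K φK σ b z
    σweight∘φ∘unweight z = ≈K.trans
      (IsLinear.cong (mono*-linear (σ a) (+ (b * n))) (φK-mono* a⁻¹ (ℤ.- (+ n)) z))
      (mono*-cancel (+ (b * n)) (+ b ℤ.* ℤ.- (+ n)) (φK σ b z) σa⋆σa⁻¹≈1 exponents)
      where
      σa⋆σa⁻¹≈1 : σ a ⋆ σ a⁻¹ ≈ 1#
      σa⋆σa⁻¹≈1 = trans (sym (*-homo a a⁻¹)) (trans (⟦⟧-cong a⋆a⁻¹≈1) 1#-homo)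
      exponents : + (b * n) ℤ.+ + b ℤ.* ℤ.- (+ n) ≡ + 0
      exponents = P.trans (P.cong (ℤ._+ (+ b ℤ.* ℤ.- (+ n))) (ℤP.pos-* b n)) (opposite (+ b) (+ n))
        where opposite : ∀ x y → x ℤ.* y ℤ.+ x ℤ.* ℤ.- y ≡ + 0
              opposite = solve-∀

    -- to: y ↦ (a u^n y_{d-1}, y_0, …, y_{d-2})
    rotateRight : ∀ {d'} → Fin (suc d') → Fin (suc d')
    rotateRight {d'} zero = fromℕ d'
    rotateRight (suc i) = inject₁ i

    weightRight : ∀ {d'} → Fin (suc d') → K → K
    weightRight zero = weight
    weightRight (suc i) = λ z → z

    weightRight-linear : ∀ {d'} (i : Fin (suc d')) → IsLinear (weightRight i)
    weightRight-linear zero = mono*-linear a (+ n)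
    weightRight-linear (suc i) = id-linear

    shiftTo : ∀ {d'} → Vect (suc d') → Vect (suc d')
    shiftTo = weightedPerm rotateRight weightRight

    -- from: x ↦ (x_1, …, x_{d-1}, a⁻¹ u^{-n} x_0), defined through the view of
    -- an index of Fin (suc d') as either  fromℕ d'  or  inject₁ j.
    rotateLeft : ∀ {d'} {i : Fin (suc d')} → View i → Fin (suc d')
    rotateLeft ‵fromℕ = zero
    rotateLeft (‵inject₁ j) = suc j

    weightLeft : ∀ {d'} {i : Fin (suc d')} → View i → K → K
    weightLeft ‵fromℕ = unweight
    weightLeft (‵inject₁ j) = λ z → z

    weightLeft-linear : ∀ {d'} {i : Fin (suc d')} (v : View i) → IsLinear (weightLeft v)
    weightLeft-linear ‵fromℕ = mono*-linear a⁻¹ (ℤ.- (+ n))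
    weightLeft-linear (‵inject₁ j) = id-linear

    shiftFrom : ∀ {d'} → Vect (suc d') → Vect (suc d')
    shiftFrom = weightedPerm (λ i → rotateLeft (view i)) (λ i → weightLeft (view i))

    shiftFrom-fromℕ : ∀ {d'} x → shiftFrom x (fromℕ d') ≡ unweight (x zero)
    shiftFrom-fromℕ {d'} x rewrite view-fromℕ d' = P.refl

    shiftFrom-inject₁ : ∀ {d'} x (j : Fin d') → shiftFrom x (inject₁ j) ≡ x (suc j)
    shiftFrom-inject₁ x j rewrite view-inject₁ j = P.refl

    open SetoidReasoning K-setoid

    shiftTo-commutes : ∀ {d'} y →
      shiftTo (φD σ b (suc d') (b * n) (σ a) y) ≈V φD σ b (suc d') n a (shiftTo y)
    shiftTo-commutes {zero} y zero = IsLinear.cong (mono*-linear a (+ n)) (≈K.sym (φK-mono*ℕ a n (y zero)))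
    shiftTo-commutes {suc e} y zero = ≈K.refl
    shiftTo-commutes {suc e} y (suc zero) = ≈K.sym (φK-mono*ℕ a n (y (fromℕ (suc e))))
    shiftTo-commutes {suc e} y (suc (suc i)) = ≈K.refl

    shiftFrom-commutes : ∀ {d'} x →
      shiftFrom (φD σ b (suc d') n a x) ≈V φD σ b (suc d') (b * n) (σ a) (shiftFrom x)
    shiftFrom-commutes {zero} x zero =
      ≈K.trans (unweight∘weight _) (≈K.sym (σweight∘φ∘unweight (x zero)))
    shiftFrom-commutes {suc e} x = lastOrInject last λ { zero → first ; (suc j) → middle j }
      where
      last : shiftFrom (φD σ b _ n a x) (fromℕ (suc e)) ≈K φK σ b (shiftFrom x (inject₁ (fromℕ e)))
      last = begin
        shiftFrom (φD σ b _ n a x) (fromℕ (suc e))     ≡⟨ shiftFrom-fromℕ (φD σ b _ n a x) ⟩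
        unweight (weight (φK σ b (x (fromℕ (suc e)))))  ≈⟨ unweight∘weight _ ⟩
        φK σ b (x (suc (fromℕ e)))                      ≡⟨ P.cong (φK σ b) (shiftFrom-inject₁ x (fromℕ e)) ⟨
        φK σ b (shiftFrom x (inject₁ (fromℕ e)))        ∎
      first : shiftFrom (φD σ b _ n a x) zero ≈K φD σ b _ (b * n) (σ a) (shiftFrom x) zero
      first = begin
        shiftFrom (φD σ b _ n a x) (inject₁ zero)                        ≡⟨ shiftFrom-inject₁ (φD σ b _ n a x) zero ⟩
        φK σ b (x zero)                                                  ≈⟨ σweight∘φ∘unweight (x zero) ⟨
        mono (σ a) (+ (b * n)) *K φK σ b (unweight (x zero))             ≡⟨ P.cong (λ z → mono (σ a) (+ (b * n)) *K φK σ b z) (shiftFrom-fromℕ x) ⟨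
        mono (σ a) (+ (b * n)) *K φK σ b (shiftFrom x (fromℕ (suc e)))   ∎
      middle : ∀ j → shiftFrom (φD σ b _ n a x) (inject₁ (suc j)) ≈K φK σ b (shiftFrom x (inject₁ (inject₁ j)))
      middle j = begin
        shiftFrom (φD σ b _ n a x) (inject₁ (suc j))   ≡⟨ shiftFrom-inject₁ (φD σ b _ n a x) (suc j) ⟩
        φK σ b (x (suc (inject₁ j)))                    ≡⟨ P.cong (φK σ b) (shiftFrom-inject₁ x (inject₁ j)) ⟨
        φK σ b (shiftFrom x (inject₁ (inject₁ j)))      ∎

    shiftFrom∘shiftTo : ∀ {d'} y → shiftFrom {d'} (shiftTo y) ≈V y
    shiftFrom∘shiftTo {d'} y = lastOrInject
      (≈K.trans (≈K.reflexive (shiftFrom-fromℕ (shiftTo y))) (unweight∘weight (y (fromℕ d'))))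
      (λ j → ≈K.reflexive (shiftFrom-inject₁ (shiftTo y) j))

    shiftTo∘shiftFrom : ∀ {d'} x → shiftTo {d'} (shiftFrom x) ≈V x
    shiftTo∘shiftFrom x zero = ≈K.trans (≈K.reflexive (P.cong weight (shiftFrom-fromℕ x))) (weight∘unweight (x zero))
    shiftTo∘shiftFrom x (suc j) = ≈K.reflexive (shiftFrom-inject₁ x j)

    shiftIso : ∀ {d'} → DIso σ b (suc d') (b * n) (σ a) n a
    shiftIso = record
      { to = shiftTo ; from = shiftFrom
      ; to-mor = weightedPerm-isMorphism _ _ weightRight-linear shiftTo-commutes
      ; from-mor = weightedPerm-isMorphism _ _ (λ i → weightLeft-linear (view i)) shiftFrom-commutes
      ; from∘to = shiftFrom∘shiftTo ; to∘from = shiftTo∘shiftFrom }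

  iter-unit : ∀ s {a a⁻¹} → a ⋆ a⁻¹ ≈ 1# → iter σ s a ⋆ iter σ s a⁻¹ ≈ 1#
  iter-unit zero a⋆a⁻¹≈1 = a⋆a⁻¹≈1
  iter-unit (suc s) {a} {a⁻¹} a⋆a⁻¹≈1 =
    trans (sym (*-homo (iter σ s a) (iter σ s a⁻¹))) (trans (⟦⟧-cong (iter-unit s a⋆a⁻¹≈1)) 1#-homo)

  iteratedShiftIso : ∀ {d'} s {n a a⁻¹} → a ⋆ a⁻¹ ≈ 1# → DIso σ b (suc d') (b ^ s * n) (iter σ s a) n a
  iteratedShiftIso {d'} zero {n} {a} _ =
    P.subst (λ m → DIso σ b (suc d') m a n a) (P.sym (ℕP.*-identityˡ n)) identityIso
  iteratedShiftIso {d'} (suc s) {n} {a} a⋆a⁻¹≈1 = isoTrans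
    (P.subst (λ m → DIso σ b (suc d') m (iter σ (suc s) a) (b ^ s * n) (iter σ s a))
      (P.sym (ℕP.*-assoc b (b ^ s) n))
      (Shift.shiftIso (iter-unit s a⋆a⁻¹≈1)))
    (iteratedShiftIso s a⋆a⁻¹≈1)

+∸1 : ∀ m → 0 < m → + (m ∸ 1) ≡ + m ℤ.- + 1
+∸1 m 0<m = P.trans (P.sym (ℤP.⊖-≥ 0<m)) (P.sym (ℤP.m-n≡m⊖n m 1))

mainTheorem2 : ∀ {c ℓ : Level} (p : ℕ) (k : CommutativeRing c ℓ)
    → FieldNotions.IsAlgClosureOfFp k p
    → (σ : CommutativeRing.Carrier k → CommutativeRing.Carrier k)
    → FieldNotions.IsFieldAut k σ
    → (b : ℕ) → 1 < b
    → (d n n' : ℕ) → 1 ≤ d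
    → (a a' : CommutativeRing.Carrier k)
    → ¬ (CommutativeRing._≈_ k a (CommutativeRing.0# k))
    → ¬ (CommutativeRing._≈_ k a' (CommutativeRing.0# k))
    → (s : ℕ)
    → (+ (b ^ d ∸ 1)) ∣ (+ n - + (b ^ s * n'))
    → CommutativeRing._≈_ k a (FieldNotions.iter k σ s a')
    → Laurent.DIso k σ b d n a n' a'
mainTheorem2 p k k-closure σ σ-aut b 1<b (suc d') n n' _ a a' _ a'≉0 s b^d-1∣n-bˢn' a≈σˢa'
  with ℤDS.∣ᵤ⇒∣ b^d-1∣n-bˢn'
... | ℤDS.divides q n-bˢn'≡q[b^d∸1] = isoTrans twist (iteratedShiftIso s (proj₂ a'-unit))
  where
  open Isomorphisms k σ (RingMorphisms.IsRingIsomorphism.isRingHomomorphism σ-aut) b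
  -- k is a field, so a' is a unit.
  a'-unit : ∃ λ a'⁻¹ → CommutativeRing._≈_ k (CommutativeRing._*_ k a' a'⁻¹) (CommutativeRing.1# k)
  a'-unit = proj₂ (proj₁ (proj₂ k-closure)) a' a'≉0
  -- b^d > 0, so the divisibility hypothesis reads n - b^s n' = q (b^d - 1).
  n-bˢn'≡q[b^d-1] : + n ℤ.- + (b ^ s * n') ≡ q ℤ.* (+ (b ^ suc d') ℤ.- + 1)
  n-bˢn'≡q[b^d-1] = P.trans n-bˢn'≡q[b^d∸1]
    (P.cong (q ℤ.*_) (+∸1 (b ^ suc d') (ℕP.m^n>0 b {{>-nonZero (ℕP.<⇒≤ 1<b)}} (suc d'))))
  twist : Laurent.DIso k σ b (suc d') n a (b ^ s * n') (FieldNotions.iter k σ s a')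
  twist = Twist.twistIso d' q a≈σˢa' n-bˢn'≡q[b^d-1]
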